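{- The line graph of the Hoffman–Singleton graph is not a Cayley graph.
   Context: The Hoffman–Singleton graph is the unique strongly regular graph with parameters $(50,7,0,1)$. A graph is a Cayley graph if it is isomorphic to $\mathrm{Cay}(G,S)$ for some finite group $G$ with identity $e$ and inverse-closed $S\subseteq G\setminus\{e\}$, where $a\sim b$ iff $ab^{ -1}\in S$. -}

module Defs where

open import Data.Nat using (ℕ; _+_; _*_; _∸_; _<ᵇ_; _≡ᵇ_; _%_; _/_)
open import Data.Bool using (Bool; true; false; _∧_; _∨_; T; if_then_else_)
open import Data.Fin using (Fin; toℕ; _<_)
open import Data.Product using (Σ; _×_; _,_; proj₁)
open import Data.Sum using (_⊎_)
open import Relation.Binary.PropositionalEquality using (_≡_; _≢_)
open import Algebra.Structures using (IsGroup)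
open import Function.Bundles using (_↔_; _⇔_; Inverse)
open import Relation.Nullary using (¬_)

record Graph : Set₁ where
  field
    V   : Set
    Adj : V → V → Set

-- Hoffman–Singleton graph (Robertson's pentagon/pentagram construction).
-- Vertex x : Fin 50 with n = toℕ x:
--   n < 25  : P(h,j) with h = n / 5, j = n % 5
--   n ≥ 25  : Q(i,k) with i = (n ∸ 25) / 5, k = (n ∸ 25) % 5
-- Edges (all indices mod 5):
--   P(h,j) ~ P(h,j±1)   (pentagons)
--   Q(i,k) ~ Q(i,k±2)   (pentagrams)
--   P(h,j) ~ Q(i,h*i+j) (and symmetrically)

hsAdjℕ : ℕ → ℕ → Bool
hsAdjℕ x y with x <ᵇ 25 | y <ᵇ 25
... | true  | true  =
  (h ≡ᵇ h′) ∧ ((j′ ≡ᵇ (j + 1) % 5) ∨ (j′ ≡ᵇ (j + 4) % 5))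
  where h = x / 5 ; j = x % 5 ; h′ = y / 5 ; j′ = y % 5
... | false | false =
  (i ≡ᵇ i′) ∧ ((k′ ≡ᵇ (k + 2) % 5) ∨ (k′ ≡ᵇ (k + 3) % 5))
  where i = (x ∸ 25) / 5 ; k = (x ∸ 25) % 5 ; i′ = (y ∸ 25) / 5 ; k′ = (y ∸ 25) % 5
... | true  | false = k ≡ᵇ (h * i + j) % 5
  where h = x / 5 ; j = x % 5 ; i = (y ∸ 25) / 5 ; k = (y ∸ 25) % 5
... | false | true  = k ≡ᵇ (h * i + j) % 5
  where h = y / 5 ; j = y % 5 ; i = (x ∸ 25) / 5 ; k = (x ∸ 25) % 5

hsAdj : Fin 50 → Fin 50 → Bool
hsAdj x y = hsAdjℕ (toℕ x) (toℕ y)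

HoffmanSingleton : Graph
HoffmanSingleton = record { V = Fin 50 ; Adj = λ x y → T (hsAdj x y) }

-- Line graph of a simple graph on Fin n with Boolean adjacency.
-- Vertices: edges {u,v}, represented uniquely as (u , v) with u < v.
-- Two distinct edges are adjacent iff they share an endpoint.

Edge : (n : ℕ) → (Fin n → Fin n → Bool) → Set
Edge n adj = Σ (Fin n × Fin n) λ { (u , v) → (u < v) × T (adj u v) }

LineGraph : (n : ℕ) → (Fin n → Fin n → Bool) → Graph
LineGraph n adj = record
  { V   = Edge n adj
  ; Adj = λ { ((u , v) , _) ((u′ , v′) , _) →
              ((u , v) ≢ (u′ , v′)) ×
              ((u ≡ u′) ⊎ (u ≡ v′) ⊎ (v ≡ u′) ⊎ (v ≡ v′)) }
  }

-- Finite groups (carrier Fin order, propositional equality; every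
-- finite group is isomorphic to one of this form).

record FinGroup : Set where
  field
    order   : ℕ
    _∙_     : Fin order → Fin order → Fin order
    ε       : Fin order
    _⁻¹     : Fin order → Fin order
    isGroup : IsGroup _≡_ _∙_ ε _⁻¹

record ConnectionSet (G : FinGroup) : Set where
  open FinGroup G
  field
    S         : Fin order → Bool
    noId      : S ε ≡ false
    invClosed : ∀ x → S x ≡ true → S (x ⁻¹) ≡ true

Cay : (G : FinGroup) → ConnectionSet G → Graph
Cay G C = record
  { V   = Fin order
  ; Adj = λ a b → T (S (a ∙ (b ⁻¹)))
  }
  where open FinGroup G ; open ConnectionSet C

_≅_ : Graph → Graph → Set
Γ ≅ Δ = Σ (Graph.V Γ ↔ Graph.V Δ) λ φ →
          ∀ x y → Graph.Adj Γ x y ⇔ Graph.Adj Δ (Inverse.to φ x) (Inverse.to φ y)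

IsCayley : Graph → Set
IsCayley Γ = Σ FinGroup λ G → Σ (ConnectionSet G) λ C → Γ ≅ Cay G C

module Submission where

-- We prove, more generally, that L(Γ) is not a Cayley graph when Γ is
-- triangle-free, p-regular for an odd prime p, and has an odd closed walk.
-- Suppose L(Γ) ≅ Cay(G,S), so group elements label the edges of Γ.  Right
-- translations are automorphisms of Cay(G,S), and since triangles of L(Γ)
-- are stars they induce an action of G on the vertices of Γ (Whitney) with
-- w ∈ edge r ⇒ act g w ∈ edge (r g).  As the degree is ≥ 3 some g ≠ ε fixes
-- a vertex z.  The p edges at z are permuted by right multiplication by g,
-- so ord g divides p, i.e. the star at z is the coset ⟨g⟩ and fixes z.
-- Then the orbit of z meets every edge in exactly one endpoint, so Γ would
-- be bipartite.

open import Defs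
open import Level using (0ℓ)
open import Data.Nat using (ℕ; zero; suc; _+_; _*_; _∸_; _≤_; _<_; z≤n; s≤s; _<ᵇ_; _%_; _/_; _<?_)
import Data.Nat.Properties as ℕ
open import Data.Nat.DivMod using (_mod_)
open import Data.Nat.Divisibility using (_∣_; ∣m∣n⇒∣m+n; ∣-refl; _∣0)
open import Data.Nat.Primality using (Prime; prime?; prime⇒irreducible)
open import Data.Bool using (Bool; true; false; T)
open import Data.Bool.Properties using (T?; T-irrelevant)
import Data.Fin as Fin
open import Data.Fin using (Fin; toℕ; fromℕ<)
open import Data.Fin.Properties using (_≟_; all?; any?; <-irrelevant; <-asym; <-cmp; pigeonhole; toℕ-injective; toℕ<n; toℕ-fromℕ<; fromℕ<-injective)
open import Data.List using (List; []; _∷_; length; filter; tabulate)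
open import Data.List.Properties using (length-tabulate)
open import Data.List.Membership.Propositional using (_∈_; _∉_)
open import Data.List.Membership.Propositional.Properties using (∈-tabulate⁺; ∈-tabulate⁻; ∈-filter⁺; ∈-filter⁻)
open import Data.List.Membership.Propositional.Properties.WithK using (unique∧set⇒bag)
open import Data.List.Membership.DecPropositional using () renaming (_∈?_ to ∈?)
open import Data.List.Relation.Unary.Any using (here)
open import Data.List.Relation.Unary.Unique.Propositional using (Unique)
open import Data.List.Relation.Unary.Unique.Propositional.Properties using (tabulate⁺; filter⁺)
open import Data.List.Relation.Binary.BagAndSetEquality using (∼bag⇒↭)
open import Data.List.Relation.Binary.Permutation.Propositional.Properties using (↭-length)
open import Data.Product using (Σ; ∃; ∃₂; _×_; _,_; proj₁; proj₂)
open import Data.Sum using (_⊎_; inj₁; inj₂)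
open import Data.Empty using (⊥; ⊥-elim)
open import Function using (_∘_; _⇔_; mk⇔)
open import Function.Bundles using (Inverse; Equivalence)
open import Algebra.Bundles using (Group)
open import Algebra.Structures using (IsGroup)
import Algebra.Properties.Group as GroupProperties
open import Relation.Binary.PropositionalEquality using (_≡_; _≢_; refl; sym; trans; cong; subst; subst₂; module ≡-Reasoning)
open import Relation.Binary.Definitions using (tri<; tri≈; tri>)
open import Relation.Nullary using (¬_; yes; no)
open import Relation.Nullary.Decidable using (from-yes; ¬?; _×-dec_; _→-dec_)
import Relation.Unary as U

least-witness : {P : ℕ → Set} → U.Decidable P → ∀ {n} → P n →
                ∃ λ m → P m × (∀ k → k < m → ¬ P k)
least-witness {P} P? {n} Pn = search 0 n (λ _ ()) (subst P (sym (ℕ.+-identityʳ n)) Pn)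
  where
  search : ∀ s b → (∀ k → k < s → ¬ P k) → P (b + s) → ∃ λ m → P m × (∀ k → k < m → ¬ P k)
  search s b below P[b+s] with P? s
  ... | yes Ps = s , Ps , below
  search s zero    below Ps | no ¬Ps = ⊥-elim (¬Ps Ps)
  search s (suc b) below P[b+s] | no ¬Ps =
    search (suc s) b below′ (subst P (sym (ℕ.+-suc b s)) P[b+s])
    where
    below′ : ∀ k → k < suc s → ¬ P k
    below′ k k<1+s with ℕ.m<1+n⇒m<n∨m≡n k<1+s
    ... | inj₁ k<s  = below k k<s
    ... | inj₂ refl = ¬Ps

module _ {A : Set} where

  length-filter-split : {P : U.Pred A 0ℓ} (P? : U.Decidable P) (xs : List A) →
                        length xs ≡ length (filter P? xs) + length (filter (¬? ∘ P?) xs)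
  length-filter-split P? [] = refl
  length-filter-split P? (x ∷ xs) with P? x
  ... | yes _ = cong suc (length-filter-split P? xs)
  ... | no  _ = trans (cong suc (length-filter-split P? xs)) (sym (ℕ.+-suc _ _))

  same-members⇒same-length : {xs ys : List A} → Unique xs → Unique ys →
                             (∀ {z} → z ∈ xs ⇔ z ∈ ys) → length xs ≡ length ys
  same-members⇒same-length uxs uys same = ↭-length (∼bag⇒↭ (unique∧set⇒bag uxs uys same))

  length-zero-∉ : {xs : List A} {y : A} → length xs ≡ 0 → y ∉ xs
  length-zero-∉ {[]} _ ()

record ThreeIndices (d : ℕ) : Set where
  field
    i₀ i₁ i₂ : Fin d
    i₀≢i₁    : i₀ ≢ i₁
    i₀≢i₂    : i₀ ≢ i₂
    i₁≢i₂    : i₁ ≢ i₂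

three-indices : ∀ {d} → 2 < d → ThreeIndices d
three-indices {d} 2<d = record
  { i₀ = fromℕ< 0<d ; i₁ = fromℕ< 1<d ; i₂ = fromℕ< 2<d
  ; i₀≢i₁ = λ eq → 0≢1 (fromℕ<-injective 0 1 0<d 1<d eq)
  ; i₀≢i₂ = λ eq → 0≢2 (fromℕ<-injective 0 2 0<d 2<d eq)
  ; i₁≢i₂ = λ eq → 1≢2 (fromℕ<-injective 1 2 1<d 2<d eq)
  }
  where
  1<d : 1 < d
  1<d = ℕ.<-trans (ℕ.n<1+n 1) 2<d
  0<d : 0 < d
  0<d = ℕ.<-trans ℕ.0<1+n 1<d
  0≢1 : 0 ≢ 1
  0≢1 ()
  0≢2 : 0 ≢ 2
  0≢2 ()
  1≢2 : 1 ≢ 2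
  1≢2 ()

-- Graphs: regularity, triangle-freeness and odd closed walks.

-- A simple graph on Fin n given by a Boolean adjacency matrix, regular of
-- degree d with an explicit enumeration of every neighbourhood, in which
-- neighbourhoods are independent sets (i.e. the graph is triangle-free).
record RegularTriangleFree (n d : ℕ) (adj : Fin n → Fin n → Bool) : Set where
  field
    irreflexive               : ∀ x → ¬ T (adj x x)
    symmetric                 : ∀ x y → T (adj x y) → T (adj y x)
    neighbour                 : Fin n → Fin d → Fin n
    neighbour-adjacent        : ∀ x i → T (adj x (neighbour x i))
    neighbour-complete        : ∀ x y → T (adj x y) → ∃ λ i → neighbour x i ≡ y
    neighbour-injective       : ∀ x i j → neighbour x i ≡ neighbour x j → i ≡ j
    neighbourhood-independent : ∀ x i j → ¬ T (adj (neighbour x i) (neighbour x j))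

  adjacent⇒distinct : ∀ {x y} → T (adj x y) → x ≢ y
  adjacent⇒distinct {x} a refl = irreflexive x a

  triangle-free : ∀ {x y w} → T (adj x y) → T (adj x w) → ¬ T (adj y w)
  triangle-free {x} {y} {w} xy xw yw
    with i , refl ← neighbour-complete x y xy
       | j , refl ← neighbour-complete x w xw
    = neighbourhood-independent x i j yw

record OddClosedWalk {n : ℕ} (adj : Fin n → Fin n → Bool) : Set where
  field
    half   : ℕ
    vertex : ℕ → Fin n
    step   : ∀ i → i < suc (2 * half) → T (adj (vertex i) (vertex (suc i)))
    closed : vertex (suc (2 * half)) ≡ vertex 0

-- A vertex set containing exactly one endpoint of every edge, i.e. one side
-- of a bipartition.
record EdgeTransversal {n : ℕ} (adj : Fin n → Fin n → Bool) (I : Fin n → Set) : Set where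
  field
    covers      : ∀ a b → T (adj a b) → I a ⊎ I b
    independent : ∀ a b → T (adj a b) → I a → I b → ⊥

-- Membership in a transversal alternates along a walk, which cannot close
-- up after an odd number of steps.
module OddWalkParity {n adj} {I : Fin n → Set} (W : OddClosedWalk {n} adj) (tr : EdgeTransversal adj I) where
  open OddClosedWalk W
  open EdgeTransversal tr

  private
    ℓ : ℕ
    ℓ = suc (2 * half)

  two-steps : ∀ i → 2 + i ≤ ℓ → I (vertex i) → I (vertex (2 + i))
  two-steps i le Ii with covers _ _ (step (suc i) le)
  ... | inj₁ Ii+1 = ⊥-elim (independent _ _ (step i (ℕ.<⇒≤ le)) Ii Ii+1)
  ... | inj₂ Ii+2 = Ii+2

  even-steps : ∀ j i → 2 * j + i ≤ ℓ → I (vertex i) → I (vertex (2 * j + i))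
  even-steps zero    i _  Ii = Ii
  even-steps (suc j) i le Ii =
    subst (I ∘ vertex) (sym 2[1+j]+i) (two-steps (2 * j + i) le′ (even-steps j i le″ Ii))
    where
    2[1+j]+i : 2 * suc j + i ≡ 2 + (2 * j + i)
    2[1+j]+i = cong (_+ i) (ℕ.*-suc 2 j)
    le′ : 2 + (2 * j + i) ≤ ℓ
    le′ = subst (_≤ ℓ) 2[1+j]+i le
    le″ : 2 * j + i ≤ ℓ
    le″ = ℕ.≤-trans (ℕ.m≤n+m (2 * j + i) 2) le′

  contradiction : ⊥
  contradiction with covers _ _ (step 0 (s≤s z≤n))
  ... | inj₁ I₀ = independent _ _ (step (2 * half) ℕ.≤-refl) I[2half] (subst I (sym closed) I₀)
    where
    I[2half] : I (vertex (2 * half))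
    I[2half] = subst (I ∘ vertex) (ℕ.+-identityʳ _)
      (even-steps half 0 (ℕ.≤-trans (ℕ.≤-reflexive (ℕ.+-identityʳ _)) (ℕ.n≤1+n _)) I₀)
  ... | inj₂ I₁ = independent _ _ (step 0 (s≤s z≤n)) (subst I closed I[ℓ]) I₁
    where
    I[ℓ] : I (vertex ℓ)
    I[ℓ] = subst (I ∘ vertex) (ℕ.+-comm (2 * half) 1)
      (even-steps half 1 (ℕ.≤-reflexive (ℕ.+-comm (2 * half) 1)) I₁)

odd-walk-no-transversal : ∀ {n adj} {I : Fin n → Set} → OddClosedWalk {n} adj → ¬ EdgeTransversal adj I
odd-walk-no-transversal W tr = OddWalkParity.contradiction W tr

-- Edges of a triangle-free graph and adjacency in its line graph.

module LineGraphEdges {n d : ℕ} {adj : Fin n → Fin n → Bool} (Γ : RegularTriangleFree n d adj) where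

  open RegularTriangleFree Γ

  lower upper : Edge n adj → Fin n
  lower ((u , _) , _) = u
  upper ((_ , v) , _) = v

  lower<upper : ∀ e → lower e Fin.< upper e
  lower<upper (_ , lt , _) = lt

  infix 4 _∈ₑ_
  _∈ₑ_ : Fin n → Edge n adj → Set
  w ∈ₑ e = w ≡ lower e ⊎ w ≡ upper e

  Meet : Edge n adj → Edge n adj → Set
  Meet e e′ = ∃ λ w → w ∈ₑ e × w ∈ₑ e′

  LineAdj : Edge n adj → Edge n adj → Set
  LineAdj = Graph.Adj (LineGraph n adj)

  edge-≡ : ∀ {e e′} → lower e ≡ lower e′ → upper e ≡ upper e′ → e ≡ e′
  edge-≡ {(u , v) , lt , a} {(.u , .v) , lt′ , a′} refl refl
    rewrite <-irrelevant lt lt′ | T-irrelevant a a′ = refl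

  endpoints : ∀ {w₁ w₂} e → w₁ ≢ w₂ → w₁ ∈ₑ e → w₂ ∈ₑ e →
              (w₁ ≡ lower e × w₂ ≡ upper e) ⊎ (w₁ ≡ upper e × w₂ ≡ lower e)
  endpoints e ne (inj₁ p) (inj₁ q) = ⊥-elim (ne (trans p (sym q)))
  endpoints e ne (inj₁ p) (inj₂ q) = inj₁ (p , q)
  endpoints e ne (inj₂ p) (inj₁ q) = inj₂ (p , q)
  endpoints e ne (inj₂ p) (inj₂ q) = ⊥-elim (ne (trans p (sym q)))

  only-two-ends : ∀ {u v x} e → u ≢ v → u ∈ₑ e → v ∈ₑ e → x ∈ₑ e → x ≡ u ⊎ x ≡ v
  only-two-ends e u≢v u∈ v∈ (inj₁ x≡l) with endpoints e u≢v u∈ v∈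
  ... | inj₁ (u≡l , _) = inj₁ (trans x≡l (sym u≡l))
  ... | inj₂ (_ , v≡l) = inj₂ (trans x≡l (sym v≡l))
  only-two-ends e u≢v u∈ v∈ (inj₂ x≡h) with endpoints e u≢v u∈ v∈
  ... | inj₁ (_ , v≡h) = inj₂ (trans x≡h (sym v≡h))
  ... | inj₂ (u≡h , _) = inj₁ (trans x≡h (sym u≡h))

  edge-determined : ∀ {w₁ w₂} e e′ → w₁ ≢ w₂ → w₁ ∈ₑ e → w₂ ∈ₑ e → w₁ ∈ₑ e′ → w₂ ∈ₑ e′ → e ≡ e′
  edge-determined e e′ ne a b c d with endpoints e ne a b | endpoints e′ ne c d
  ... | inj₁ (p₁ , p₂) | inj₁ (q₁ , q₂) = edge-≡ (trans (sym p₁) q₁) (trans (sym p₂) q₂)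
  ... | inj₂ (p₁ , p₂) | inj₂ (q₁ , q₂) = edge-≡ (trans (sym p₂) q₂) (trans (sym p₁) q₁)
  ... | inj₁ (p₁ , p₂) | inj₂ (q₁ , q₂) =
    ⊥-elim (<-asym (lower<upper e) (subst₂ Fin._<_ (trans (sym q₂) p₂) (trans (sym q₁) p₁) (lower<upper e′)))
  ... | inj₂ (p₁ , p₂) | inj₁ (q₁ , q₂) =
    ⊥-elim (<-asym (lower<upper e) (subst₂ Fin._<_ (trans (sym q₁) p₁) (trans (sym q₂) p₂) (lower<upper e′)))

  meet-unique : ∀ {w₁ w₂} e e′ → e ≢ e′ → w₁ ∈ₑ e → w₁ ∈ₑ e′ → w₂ ∈ₑ e → w₂ ∈ₑ e′ → w₁ ≡ w₂
  meet-unique {w₁} {w₂} e e′ e≢e′ a b c d with w₁ ≟ w₂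
  ... | yes w₁≡w₂ = w₁≡w₂
  ... | no  w₁≢w₂ = ⊥-elim (e≢e′ (edge-determined e e′ w₁≢w₂ a c b d))

  ends-adjacent : ∀ {w₁ w₂} e → w₁ ≢ w₂ → w₁ ∈ₑ e → w₂ ∈ₑ e → T (adj w₁ w₂)
  ends-adjacent e ne a b with endpoints e ne a b
  ... | inj₁ (refl , refl) = proj₂ (proj₂ e)
  ... | inj₂ (refl , refl) = symmetric _ _ (proj₂ (proj₂ e))

  -- In a triangle-free graph every triangle of the line graph is a star:
  -- if distinct edges e₁, e₂ meet in w and e₃ meets both, then w ∈ e₃.
  triangle-is-star : ∀ {w c₁ c₂} e₁ e₂ e₃ → e₁ ≢ e₂ → w ∈ₑ e₁ → w ∈ₑ e₂ →
                     c₁ ∈ₑ e₁ → c₁ ∈ₑ e₃ → c₂ ∈ₑ e₂ → c₂ ∈ₑ e₃ → w ∈ₑ e₃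
  triangle-is-star {w} {c₁} {c₂} e₁ e₂ e₃ e₁≢e₂ w₁ w₂ c₁₁ c₁₃ c₂₂ c₂₃ with c₁ ≟ w | c₂ ≟ w
  ... | yes refl | _        = c₁₃
  ... | no _     | yes refl = c₂₃
  ... | no c₁≢w  | no c₂≢w with c₁ ≟ c₂
  ...   | yes refl = ⊥-elim (e₁≢e₂ (edge-determined e₁ e₂ (c₁≢w ∘ sym) w₁ c₁₁ w₂ c₂₂))
  ...   | no c₁≢c₂ = ⊥-elim (triangle-free (ends-adjacent e₁ (c₁≢w ∘ sym) w₁ c₁₁)
                                            (ends-adjacent e₂ (c₂≢w ∘ sym) w₂ c₂₂)
                                            (ends-adjacent e₃ c₁≢c₂ c₁₃ c₂₃))

  edgeThrough : ∀ z w → T (adj z w) → Σ (Edge n adj) λ e → z ∈ₑ e × w ∈ₑ e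
  edgeThrough z w a with <-cmp z w
  ... | tri< z<w _ _ = ((z , w) , z<w , a) , inj₁ refl , inj₂ refl
  ... | tri≈ _ refl _ = ⊥-elim (irreflexive z a)
  ... | tri> _ _ w<z = ((w , z) , w<z , symmetric z w a) , inj₂ refl , inj₁ refl

  other-end : ∀ {w} e → w ∈ₑ e → ∃ λ a → a ∈ₑ e × T (adj w a)
  other-end e (inj₁ refl) = upper e , inj₂ refl , proj₂ (proj₂ e)
  other-end e (inj₂ refl) = lower e , inj₁ refl , symmetric _ _ (proj₂ (proj₂ e))

  lineAdj⇒meet : ∀ e e′ → LineAdj e e′ → e ≢ e′ × Meet e e′
  lineAdj⇒meet e e′ (ne , shared) = (ne ∘ cong proj₁) , common shared
    where
    common : _ → Meet e e′
    common (inj₁ p)               = lower e , inj₁ refl , inj₁ p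
    common (inj₂ (inj₁ p))        = lower e , inj₁ refl , inj₂ p
    common (inj₂ (inj₂ (inj₁ p))) = upper e , inj₂ refl , inj₁ p
    common (inj₂ (inj₂ (inj₂ p))) = upper e , inj₂ refl , inj₂ p

  meet⇒lineAdj : ∀ e e′ → e ≢ e′ → Meet e e′ → LineAdj e e′
  meet⇒lineAdj e e′ ne (w , w∈e , w∈e′) =
    (λ eq → ne (edge-≡ (cong proj₁ eq) (cong proj₂ eq))) , shared w∈e w∈e′
    where
    shared : w ∈ₑ e → w ∈ₑ e′ → _
    shared (inj₁ p) (inj₁ q) = inj₁ (trans (sym p) q)
    shared (inj₁ p) (inj₂ q) = inj₂ (inj₁ (trans (sym p) q))
    shared (inj₂ p) (inj₁ q) = inj₂ (inj₂ (inj₁ (trans (sym p) q)))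
    shared (inj₂ p) (inj₂ q) = inj₂ (inj₂ (inj₂ (trans (sym p) q)))

-- Finite groups: cancellation and the orbits of a cyclic subgroup.

module GroupFacts (G : FinGroup) where

  open FinGroup G
  open IsGroup isGroup public using (assoc; identityˡ; identityʳ; inverseʳ)

  group : Group 0ℓ 0ℓ
  group = record { Carrier = Fin order ; _≈_ = _≡_ ; _∙_ = _∙_ ; ε = ε ; _⁻¹ = _⁻¹ ; isGroup = isGroup }

  open GroupProperties group public using (∙-cancelˡ; ∙-cancelʳ; ⁻¹-anti-homo-∙; x∙y⁻¹≈ε⇒x≈y)
  open GroupProperties group using (//-rightDividesˡ; //-rightDividesʳ)

  ∙-∙⁻¹ : ∀ x g → (x ∙ g) ∙ (g ⁻¹) ≡ x
  ∙-∙⁻¹ x g = //-rightDividesʳ g x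

  ∙⁻¹-∙ : ∀ x g → (x ∙ (g ⁻¹)) ∙ g ≡ x
  ∙⁻¹-∙ x g = //-rightDividesˡ g x

  -- Right translation preserves the quotient x y⁻¹, so it is an
  -- automorphism of every Cayley graph of G.
  translate-quotient : ∀ x y g → (x ∙ g) ∙ ((y ∙ g) ⁻¹) ≡ x ∙ (y ⁻¹)
  translate-quotient x y g = begin
    (x ∙ g) ∙ ((y ∙ g) ⁻¹)         ≡⟨ cong ((x ∙ g) ∙_) (⁻¹-anti-homo-∙ y g) ⟩
    (x ∙ g) ∙ ((g ⁻¹) ∙ (y ⁻¹))    ≡⟨ sym (assoc (x ∙ g) (g ⁻¹) (y ⁻¹)) ⟩
    ((x ∙ g) ∙ (g ⁻¹)) ∙ (y ⁻¹)    ≡⟨ cong (_∙ (y ⁻¹)) (∙-∙⁻¹ x g) ⟩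
    x ∙ (y ⁻¹)                     ∎
    where open ≡-Reasoning

module CyclicOrbits (G : FinGroup) (g : Fin (FinGroup.order G)) where

  open FinGroup G
  open GroupFacts G

  pow : ℕ → Fin order
  pow zero    = ε
  pow (suc k) = pow k ∙ g

  pow-+ : ∀ a b → pow (a + b) ≡ pow a ∙ pow b
  pow-+ a zero    = trans (cong pow (ℕ.+-identityʳ a)) (sym (identityʳ (pow a)))
  pow-+ a (suc b) = begin
    pow (a + suc b)       ≡⟨ cong pow (ℕ.+-suc a b) ⟩
    pow (a + b) ∙ g       ≡⟨ cong (_∙ g) (pow-+ a b) ⟩
    (pow a ∙ pow b) ∙ g   ≡⟨ assoc (pow a) (pow b) g ⟩
    pow a ∙ pow (suc b)   ∎
    where open ≡-Reasoning

  pow-collision : ∀ a b → a < b → pow a ≡ pow b → pow (b ∸ a) ≡ ε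
  pow-collision a b a<b eq = ∙-cancelˡ (pow a) (pow (b ∸ a)) ε (begin
    pow a ∙ pow (b ∸ a)   ≡⟨ sym (pow-+ a (b ∸ a)) ⟩
    pow (a + (b ∸ a))     ≡⟨ cong pow (ℕ.m+[n∸m]≡n (ℕ.<⇒≤ a<b)) ⟩
    pow b                 ≡⟨ sym eq ⟩
    pow a                 ≡⟨ sym (identityʳ (pow a)) ⟩
    pow a ∙ ε             ∎)
    where open ≡-Reasoning

  TrivialPower : ℕ → Set
  TrivialPower k = 0 < k × pow k ≡ ε

  -- By pigeonhole among ε, g, …, g^order some positive power is trivial.
  trivial-power : ∃ TrivialPower
  trivial-power with i , j , i<j , eq ← pigeonhole (ℕ.n<1+n order) (λ k → pow (toℕ k))
    = toℕ j ∸ toℕ i , ℕ.m<n⇒0<n∸m i<j , pow-collision _ _ i<j eq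

  -- Kept abstract so that the search is never unfolded during type checking.
  abstract
    order-of-g : ∃ λ m → TrivialPower m × (∀ k → k < m → ¬ TrivialPower k)
    order-of-g = least-witness (λ k → (0 <? k) ×-dec (pow k ≟ ε)) (proj₂ trivial-power)

  ord : ℕ
  ord = proj₁ order-of-g

  0<ord : 0 < ord
  0<ord = proj₁ (proj₁ (proj₂ order-of-g))

  pow-ord : pow ord ≡ ε
  pow-ord = proj₂ (proj₁ (proj₂ order-of-g))

  ord-minimal : ∀ k → k < ord → ¬ TrivialPower k
  ord-minimal = proj₂ (proj₂ order-of-g)

  no-collision : ∀ {a b} → a < b → b < ord → pow a ≢ pow b
  no-collision {a} {b} a<b b<ord eq =
    ord-minimal (b ∸ a) (ℕ.≤-<-trans (ℕ.m∸n≤m b a) b<ord) (ℕ.m<n⇒0<n∸m a<b , pow-collision a b a<b eq)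

  pow-injective : ∀ {a b} → a < ord → b < ord → pow a ≡ pow b → a ≡ b
  pow-injective {a} {b} a<ord b<ord eq with ℕ.<-cmp a b
  ... | tri< a<b _ _ = ⊥-elim (no-collision a<b b<ord eq)
  ... | tri≈ _ a≡b _ = a≡b
  ... | tri> _ _ b<a = ⊥-elim (no-collision b<a a<ord (sym eq))

  coset : Fin order → List (Fin order)
  coset x = tabulate {n = ord} (λ k → x ∙ pow (toℕ k))

  coset-unique : ∀ x → Unique (coset x)
  coset-unique x = tabulate⁺ λ {i} {j} eq →
    toℕ-injective (pow-injective (toℕ<n i) (toℕ<n j) (∙-cancelˡ x _ _ eq))

  length-coset : ∀ x → length (coset x) ≡ ord
  length-coset x = length-tabulate (λ (k : Fin ord) → x ∙ pow (toℕ k))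

  ∈-coset⁺ : ∀ x {k} → k < ord → x ∙ pow k ∈ coset x
  ∈-coset⁺ x {k} k<ord = subst (λ t → x ∙ pow t ∈ coset x) (toℕ-fromℕ< k<ord)
                               (∈-tabulate⁺ (fromℕ< k<ord))

  ∈-coset⁻ : ∀ {x y} → y ∈ coset x → ∃ λ k → k < ord × y ≡ x ∙ pow k
  ∈-coset⁻ y∈ with k , eq ← ∈-tabulate⁻ y∈ = toℕ k , toℕ<n k , eq

  ∉-coset-∙g : ∀ x y → y ∉ coset x → y ∙ g ∉ coset x
  ∉-coset-∙g x y y∉ yg∈ with ∈-coset⁻ yg∈
  ... | zero , _ , yg≡x = y∉ (subst (_∈ coset x) (sym y≡) (∈-coset⁺ x last<ord))
    where
    last : ℕ
    last = ord ∸ 1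
    last<ord : last < ord
    last<ord = ℕ.∸-monoʳ-< ℕ.0<1+n 0<ord
    y≡ : y ≡ x ∙ pow last
    y≡ = ∙-cancelʳ g y (x ∙ pow last) (begin
      y ∙ g                 ≡⟨ yg≡x ⟩
      x ∙ ε                 ≡⟨ cong (x ∙_) (sym pow-ord) ⟩
      x ∙ pow ord           ≡⟨ cong (λ t → x ∙ pow t) (sym (ℕ.m+[n∸m]≡n 0<ord)) ⟩
      x ∙ (pow last ∙ g)    ≡⟨ sym (assoc x (pow last) g) ⟩
      (x ∙ pow last) ∙ g    ∎)
      where open ≡-Reasoning
  ... | suc k , k+1<ord , yg≡x = y∉ (subst (_∈ coset x) (sym y≡) (∈-coset⁺ x (ℕ.<-trans (ℕ.n<1+n k) k+1<ord)))
    where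
    y≡ : y ≡ x ∙ pow k
    y≡ = ∙-cancelʳ g y (x ∙ pow k) (trans yg≡x (sym (assoc x (pow k) g)))

  Closed : List (Fin order) → Set
  Closed L = ∀ {y} → y ∈ L → y ∙ g ∈ L

  coset-⊆ : ∀ {L x y} → Closed L → x ∈ L → y ∈ coset x → y ∈ L
  coset-⊆ {L} {x} closed x∈L y∈ with k , _ , refl ← ∈-coset⁻ y∈ = powers k
    where
    powers : ∀ k → x ∙ pow k ∈ L
    powers zero    = subst (_∈ L) (sym (identityʳ x)) x∈L
    powers (suc k) = subst (_∈ L) (assoc x (pow k) g) (closed (powers k))

  module CosetSplit {L} (L-unique : Unique L) (L-closed : Closed L) {x} (x∈L : x ∈ L) where

    in-coset? : U.Decidable (_∈ coset x)
    in-coset? y = ∈? _≟_ y (coset x)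

    rest : List (Fin order)
    rest = filter (¬? ∘ in-coset?) L

    length-split : length L ≡ ord + length rest
    length-split = begin
      length L                                          ≡⟨ length-filter-split in-coset? L ⟩
      length (filter in-coset? L) + length rest         ≡⟨ cong (_+ length rest) same-length ⟩
      length (coset x) + length rest                    ≡⟨ cong (_+ length rest) (length-coset x) ⟩
      ord + length rest                                 ∎
      where
      open ≡-Reasoning
      same-length : length (filter in-coset? L) ≡ length (coset x)
      same-length = same-members⇒same-length (filter⁺ in-coset? L-unique) (coset-unique x)
        (mk⇔ (proj₂ ∘ ∈-filter⁻ in-coset? {xs = L}) (λ y∈ → ∈-filter⁺ in-coset? (coset-⊆ L-closed x∈L y∈) y∈))

    rest-unique : Unique rest
    rest-unique = filter⁺ (¬? ∘ in-coset?) L-unique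

    rest-closed : Closed rest
    rest-closed {y} y∈ with y∈L , y∉ ← ∈-filter⁻ (¬? ∘ in-coset?) y∈ =
      ∈-filter⁺ (¬? ∘ in-coset?) (L-closed y∈L) (∉-coset-∙g x y y∉)

  ord-∣-length : ∀ {L} → Unique L → Closed L → ord ∣ length L
  ord-∣-length = divides _ ℕ.≤-refl
    where
    divides : ∀ bound {L} → length L ≤ bound → Unique L → Closed L → ord ∣ length L
    divides _ {[]} _ _ _ = ord ∣0
    divides (suc bound) {x ∷ L} len≤ u closed =
      subst (ord ∣_) (sym length-split) (∣m∣n⇒∣m+n ∣-refl (divides bound rest≤ rest-unique rest-closed))
      where
      open CosetSplit u closed (here refl)
      rest≤ : length rest ≤ bound
      rest≤ = ℕ.≤-pred (ℕ.≤-trans (ℕ.+-monoˡ-≤ (length rest) 0<ord) (subst (_≤ suc bound) length-split len≤))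

  ⊆-coset : ∀ {L x y} → Unique L → Closed L → length L ≡ ord → x ∈ L → y ∈ L → y ∈ coset x
  ⊆-coset {L} {x} {y} u closed len x∈L y∈L with CosetSplit.in-coset? u closed x∈L y
  ... | yes y∈ = y∈
  ... | no  y∉ = ⊥-elim (length-zero-∉ rest-empty (∈-filter⁺ (¬? ∘ in-coset?) y∈L y∉))
    where
    open CosetSplit u closed x∈L
    rest-empty : length rest ≡ 0
    rest-empty = ℕ.+-cancelˡ-≡ ord _ _ (trans (sym length-split) (trans len (sym (ℕ.+-identityʳ ord))))

-- Line graphs of triangle-free graphs that are Cayley graphs.

module LineGraphCayley {n d : ℕ} {adj : Fin n → Fin n → Bool} (Γ : RegularTriangleFree n d adj)
                       (G : FinGroup) (C : ConnectionSet G) (iso : LineGraph n adj ≅ Cay G C) where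

  open RegularTriangleFree Γ
  open LineGraphEdges Γ
  open FinGroup G
  open ConnectionSet C
  open GroupFacts G

  edge : Fin order → Edge n adj
  edge = Inverse.from (proj₁ iso)

  label : Edge n adj → Fin order
  label = Inverse.to (proj₁ iso)

  label-edge : ∀ x → label (edge x) ≡ x
  label-edge = Inverse.strictlyInverseˡ (proj₁ iso)

  edge-label : ∀ e → edge (label e) ≡ e
  edge-label = Inverse.strictlyInverseʳ (proj₁ iso)

  edge-injective : ∀ {x y} → edge x ≡ edge y → x ≡ y
  edge-injective {x} {y} eq = trans (sym (label-edge x)) (trans (cong label eq) (label-edge y))

  CayleyAdj : Fin order → Fin order → Set
  CayleyAdj x y = T (S (x ∙ (y ⁻¹)))

  lineAdj⇔cayleyAdj : ∀ x y → LineAdj (edge x) (edge y) ⇔ CayleyAdj x y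
  lineAdj⇔cayleyAdj x y = mk⇔
    (subst₂ CayleyAdj (label-edge x) (label-edge y) ∘ Equivalence.to (proj₂ iso (edge x) (edge y)))
    (Equivalence.from (proj₂ iso (edge x) (edge y)) ∘ subst₂ CayleyAdj (sym (label-edge x)) (sym (label-edge y)))

  translate-lineAdj : ∀ g {x y} → LineAdj (edge x) (edge y) → LineAdj (edge (x ∙ g)) (edge (y ∙ g))
  translate-lineAdj g {x} {y} xy = Equivalence.from (lineAdj⇔cayleyAdj (x ∙ g) (y ∙ g))
    (subst (T ∘ S) (sym (translate-quotient x y g)) (Equivalence.to (lineAdj⇔cayleyAdj x y) xy))

  translate-distinct : ∀ g {x y} → x ≢ y → edge (x ∙ g) ≢ edge (y ∙ g)
  translate-distinct g x≢y eq = x≢y (∙-cancelʳ g _ _ (edge-injective eq))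

  translate-meet : ∀ g {x y} → x ≢ y → Meet (edge x) (edge y) → Meet (edge (x ∙ g)) (edge (y ∙ g))
  translate-meet g {x} {y} x≢y m = proj₂ (lineAdj⇒meet (edge (x ∙ g)) (edge (y ∙ g))
    (translate-lineAdj g (meet⇒lineAdj (edge x) (edge y) (x≢y ∘ edge-injective) m)))

  -- Translation maps stars to stars: if distinct edges x, y meet in w and
  -- their translates meet in w′, every edge r through w is translated to
  -- an edge through w′ (as triangles of the line graph are stars).
  translate-star : ∀ g {w w′ x y r} → x ≢ y → w ∈ₑ edge x → w ∈ₑ edge y →
                   w′ ∈ₑ edge (x ∙ g) → w′ ∈ₑ edge (y ∙ g) → w ∈ₑ edge r → w′ ∈ₑ edge (r ∙ g)
  translate-star g {w} {w′} {x} {y} {r} x≢y wx wy w′x w′y wr with r ≟ x | r ≟ y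
  ... | yes refl | _        = w′x
  ... | no _     | yes refl = w′y
  ... | no r≢x   | no r≢y
    with translate-meet g (r≢x ∘ sym) (w , wx , wr) | translate-meet g (r≢y ∘ sym) (w , wy , wr)
  ...   | c₁ , c₁x , c₁r | c₂ , c₂y , c₂r =
    triangle-is-star (edge (x ∙ g)) (edge (y ∙ g)) (edge (r ∙ g)) (translate-distinct g x≢y)
                     w′x w′y c₁x c₁r c₂y c₂r

  joining : ∀ a b → T (adj a b) → Fin order
  joining a b ab = label (proj₁ (edgeThrough a b ab))

  joining-∋₁ : ∀ a b ab → a ∈ₑ edge (joining a b ab)
  joining-∋₁ a b ab = subst (a ∈ₑ_) (sym (edge-label _)) (proj₁ (proj₂ (edgeThrough a b ab)))

  joining-∋₂ : ∀ a b ab → b ∈ₑ edge (joining a b ab)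
  joining-∋₂ a b ab = subst (b ∈ₑ_) (sym (edge-label _)) (proj₂ (proj₂ (edgeThrough a b ab)))

  spoke : Fin d → Fin n → Fin order
  spoke i w = joining w (neighbour w i) (neighbour-adjacent w i)

  spoke-∋-centre : ∀ i w → w ∈ₑ edge (spoke i w)
  spoke-∋-centre i w = joining-∋₁ w (neighbour w i) (neighbour-adjacent w i)

  spoke-∋-end : ∀ i w → neighbour w i ∈ₑ edge (spoke i w)
  spoke-∋-end i w = joining-∋₂ w (neighbour w i) (neighbour-adjacent w i)

  spoke-injective : ∀ w {i j} → spoke i w ≡ spoke j w → i ≡ j
  spoke-injective w {i} {j} eq
    with only-two-ends (edge (spoke j w)) (adjacent⇒distinct (neighbour-adjacent w j))
                       (spoke-∋-centre j w) (spoke-∋-end j w)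
                       (subst (λ s → neighbour w i ∈ₑ edge s) eq (spoke-∋-end i w))
  ... | inj₁ end≡w   = ⊥-elim (adjacent⇒distinct (neighbour-adjacent w i) (sym end≡w))
  ... | inj₂ end≡end = neighbour-injective w i j end≡end

  spokes-exhaust : ∀ w {y} → w ∈ₑ edge y → ∃ λ i → y ≡ spoke i w
  spokes-exhaust w {y} w∈ with a , a∈ , wa ← other-end (edge y) w∈ with neighbour-complete w a wa
  ... | i , refl = i , edge-injective (edge-determined (edge y) (edge (spoke i w)) (adjacent⇒distinct wa)
                                                        w∈ a∈ (spoke-∋-centre i w) (spoke-∋-end i w))

  -- Whitney's argument: using two distinct spokes at every vertex, the
  -- translations of the line graph induce an action of G on the vertices.
  module WhitneyAction (i₀ i₁ : Fin d) (i₀≢i₁ : i₀ ≢ i₁) where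

    spokes-distinct : ∀ w → spoke i₀ w ≢ spoke i₁ w
    spokes-distinct w = i₀≢i₁ ∘ spoke-injective w

    spokes-meet : ∀ g w → Meet (edge (spoke i₀ w ∙ g)) (edge (spoke i₁ w ∙ g))
    spokes-meet g w = translate-meet g (spokes-distinct w) (w , spoke-∋-centre i₀ w , spoke-∋-centre i₁ w)

    -- The image of w under g: the common vertex of the translated spokes at
    -- w.  (Kept abstract: only the two properties below are ever used.)
    abstract
      act : Fin order → Fin n → Fin n
      act g w = proj₁ (spokes-meet g w)

      act-∈₀ : ∀ g w → act g w ∈ₑ edge (spoke i₀ w ∙ g)
      act-∈₀ g w = proj₁ (proj₂ (spokes-meet g w))

      act-∈₁ : ∀ g w → act g w ∈ₑ edge (spoke i₁ w ∙ g)
      act-∈₁ g w = proj₂ (proj₂ (spokes-meet g w))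

    act-unique : ∀ g w {w′} → w′ ∈ₑ edge (spoke i₀ w ∙ g) → w′ ∈ₑ edge (spoke i₁ w ∙ g) → w′ ≡ act g w
    act-unique g w p q = meet-unique _ _ (translate-distinct g (spokes-distinct w)) p q (act-∈₀ g w) (act-∈₁ g w)

    act-edge : ∀ g {w r} → w ∈ₑ edge r → act g w ∈ₑ edge (r ∙ g)
    act-edge g {w} = translate-star g (spokes-distinct w) (spoke-∋-centre i₀ w) (spoke-∋-centre i₁ w)
                                      (act-∈₀ g w) (act-∈₁ g w)

    act-∙ : ∀ g h w → act h (act g w) ≡ act (g ∙ h) w
    act-∙ g h w = act-unique (g ∙ h) w (translated i₀ (act-∈₀ g w)) (translated i₁ (act-∈₁ g w))
      where
      translated : ∀ i → act g w ∈ₑ edge (spoke i w ∙ g) → act h (act g w) ∈ₑ edge (spoke i w ∙ (g ∙ h))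
      translated i p = subst (λ t → act h (act g w) ∈ₑ edge t) (assoc (spoke i w) g h) (act-edge h p)

    act-ε : ∀ w → act ε w ≡ w
    act-ε w = sym (act-unique ε w (untranslated i₀) (untranslated i₁))
      where
      untranslated : ∀ i → w ∈ₑ edge (spoke i w ∙ ε)
      untranslated i = subst (λ t → w ∈ₑ edge t) (sym (identityʳ (spoke i w))) (spoke-∋-centre i w)

    act-⁻¹ : ∀ g w → act (g ⁻¹) (act g w) ≡ w
    act-⁻¹ g w = trans (act-∙ g (g ⁻¹) w) (trans (cong (λ t → act t w) (inverseʳ g)) (act-ε w))

    act-injective : ∀ g {a b} → act g a ≡ act g b → a ≡ b
    act-injective g {a} {b} eq = trans (sym (act-⁻¹ g a)) (trans (cong (act (g ⁻¹)) eq) (act-⁻¹ g b))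

    act-from-ε : ∀ g {w} → w ∈ₑ edge ε → act g w ∈ₑ edge g
    act-from-ε g {w} w∈ = subst (λ t → act g w ∈ₑ edge t) (identityˡ g) (act-edge g w∈)

    record FixedVertex : Set where
      field
        z         : Fin n
        g         : Fin order
        z∈ε       : z ∈ₑ edge ε
        g-fixes-z : act g z ≡ z
        g≢ε       : g ≢ ε

    -- With a third spoke such an element exists: let {u₀, v₀} be the edge
    -- labelled ε and look at the labels of two edges u₀m with m ≠ v₀.
    module FindFixedVertex (i₂ : Fin d) (i₀≢i₂ : i₀ ≢ i₂) (i₁≢i₂ : i₁ ≢ i₂) where

      u₀ v₀ : Fin n
      u₀ = lower (edge ε)
      v₀ = upper (edge ε)

      u₀∈ε : u₀ ∈ₑ edge ε
      u₀∈ε = inj₁ refl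

      v₀∈ε : v₀ ∈ₑ edge ε
      v₀∈ε = inj₂ refl

      u₀≢v₀ : u₀ ≢ v₀
      u₀≢v₀ eq = ℕ.<-irrefl (cong toℕ eq) (lower<upper (edge ε))

      two-other-neighbours : ∃₂ λ i j → i ≢ j × neighbour u₀ i ≢ v₀ × neighbour u₀ j ≢ v₀
      two-other-neighbours with neighbour u₀ i₀ ≟ v₀ | neighbour u₀ i₁ ≟ v₀
      ... | yes p | yes q = ⊥-elim (i₀≢i₁ (neighbour-injective u₀ i₀ i₁ (trans p (sym q))))
      ... | yes p | no q  = i₁ , i₂ , i₁≢i₂ , q , λ r → i₀≢i₂ (neighbour-injective u₀ i₀ i₂ (trans p (sym r)))
      ... | no p  | yes q = i₀ , i₂ , i₀≢i₂ , p , λ r → i₁≢i₂ (neighbour-injective u₀ i₁ i₂ (trans q (sym r)))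
      ... | no p  | no q  = i₀ , i₁ , i₀≢i₁ , p , q

      spoke-nontrivial : ∀ i → neighbour u₀ i ≢ v₀ → spoke i u₀ ≢ ε
      spoke-nontrivial i m≢v₀ eq
        with only-two-ends (edge ε) u₀≢v₀ u₀∈ε v₀∈ε (subst (λ t → neighbour u₀ i ∈ₑ edge t) eq (spoke-∋-end i u₀))
      ... | inj₁ m≡u₀ = adjacent⇒distinct (neighbour-adjacent u₀ i) (sym m≡u₀)
      ... | inj₂ m≡v₀ = m≢v₀ m≡v₀

      -- Its label maps {u₀, v₀} onto {u₀, m}: it fixes u₀ or maps v₀ to u₀.
      spoke-at-u₀ : ∀ i → neighbour u₀ i ≢ v₀ → FixedVertex ⊎ act (spoke i u₀) v₀ ≡ u₀
      spoke-at-u₀ i m≢v₀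
        with only-two-ends (edge (spoke i u₀)) (adjacent⇒distinct (neighbour-adjacent u₀ i))
                           (spoke-∋-centre i u₀) (spoke-∋-end i u₀) (act-from-ε (spoke i u₀) u₀∈ε)
      ... | inj₁ fixes = inj₁ (record { z = u₀ ; g = spoke i u₀ ; z∈ε = u₀∈ε ; g-fixes-z = fixes
                                      ; g≢ε = spoke-nontrivial i m≢v₀ })
      ... | inj₂ u₀↦m
        with only-two-ends (edge (spoke i u₀)) (adjacent⇒distinct (neighbour-adjacent u₀ i))
                           (spoke-∋-centre i u₀) (spoke-∋-end i u₀) (act-from-ε (spoke i u₀) v₀∈ε)
      ...   | inj₁ v₀↦u₀ = inj₂ v₀↦u₀
      ...   | inj₂ v₀↦m  = ⊥-elim (u₀≢v₀ (act-injective (spoke i u₀) (trans u₀↦m (sym v₀↦m))))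

      quotient-fixes : ∀ {a b} → act a v₀ ≡ u₀ → act b v₀ ≡ u₀ → act (b ∙ (a ⁻¹)) v₀ ≡ v₀
      quotient-fixes {a} {b} a↦ b↦ = begin
        act (b ∙ (a ⁻¹)) v₀     ≡⟨ sym (act-∙ b (a ⁻¹) v₀) ⟩
        act (a ⁻¹) (act b v₀)   ≡⟨ cong (act (a ⁻¹)) (trans b↦ (sym a↦)) ⟩
        act (a ⁻¹) (act a v₀)   ≡⟨ act-⁻¹ a v₀ ⟩
        v₀                      ∎
        where open ≡-Reasoning

      fixed-vertex : FixedVertex
      fixed-vertex with i , j , i≢j , mᵢ≢v₀ , mⱼ≢v₀ ← two-other-neighbours
                      | spoke-at-u₀ i mᵢ≢v₀ | spoke-at-u₀ j mⱼ≢v₀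
      ... | inj₁ fv | _       = fv
      ... | inj₂ _  | inj₁ fv = fv
      ... | inj₂ aᵢ | inj₂ aⱼ = record
        { z = v₀ ; g = spoke j u₀ ∙ (spoke i u₀ ⁻¹) ; z∈ε = v₀∈ε ; g-fixes-z = quotient-fixes aᵢ aⱼ
        ; g≢ε = λ eq → i≢j (sym (spoke-injective u₀ (x∙y⁻¹≈ε⇒x≈y _ _ eq))) }

    module Transversal (d-prime : Prime d) (fv : FixedVertex) where

      open FixedVertex fv
      open CyclicOrbits G g

      Stabilises : Fin order → Set
      Stabilises x = act x z ≡ z

      stabilises-pow : ∀ k → Stabilises (pow k)
      stabilises-pow zero    = act-ε z
      stabilises-pow (suc k) = trans (sym (act-∙ (pow k) g z)) (trans (cong (act g) (stabilises-pow k)) g-fixes-z)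

      star : List (Fin order)
      star = tabulate (λ i → spoke i z)

      star-unique : Unique star
      star-unique = tabulate⁺ (spoke-injective z)

      length-star : length star ≡ d
      length-star = length-tabulate (λ i → spoke i z)

      ∈-star⁻ : ∀ {y} → y ∈ star → z ∈ₑ edge y
      ∈-star⁻ y∈ with i , refl ← ∈-tabulate⁻ y∈ = spoke-∋-centre i z

      ∈-star⁺ : ∀ {y} → z ∈ₑ edge y → y ∈ star
      ∈-star⁺ z∈ with i , refl ← spokes-exhaust z z∈ = ∈-tabulate⁺ i

      -- g fixes z, so right multiplication by g permutes the star at z.
      star-closed : Closed star
      star-closed y∈ = ∈-star⁺ (subst (_∈ₑ edge _) g-fixes-z (act-edge g (∈-star⁻ y∈)))

      -- The order of g divides the prime d, and g ≠ ε.
      ord≡d : ord ≡ d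
      ord≡d with prime⇒irreducible d-prime (subst (ord ∣_) length-star (ord-∣-length star-unique star-closed))
      ... | inj₂ ord≡d = ord≡d
      ... | inj₁ ord≡1 = ⊥-elim (g≢ε (begin
        g         ≡⟨ sym (identityˡ g) ⟩
        pow 1     ≡⟨ cong pow (sym ord≡1) ⟩
        pow ord   ≡⟨ pow-ord ⟩
        ε         ∎))
        where open ≡-Reasoning

      -- So the star at z is the coset ⟨g⟩, and each of its labels fixes z.
      star-stabilises : ∀ {y} → z ∈ₑ edge y → Stabilises y
      star-stabilises z∈
        with k , _ , refl ← ∈-coset⁻ (⊆-coset star-unique star-closed (trans length-star (sym ord≡d))
                                               (∈-star⁺ z∈ε) (∈-star⁺ z∈))
        = subst Stabilises (sym (identityˡ (pow k))) (stabilises-pow k)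

      Orbit : Fin n → Set
      Orbit w = ∃ λ y → act y z ≡ w

      orbit-on-edge : ∀ {w x} → w ∈ₑ edge x → Orbit w → w ≡ act x z
      orbit-on-edge {w} {x} w∈ (y , refl) = begin
        act y z                      ≡⟨ cong (act y) (sym (star-stabilises z∈)) ⟩
        act y (act (x ∙ (y ⁻¹)) z)   ≡⟨ act-∙ (x ∙ (y ⁻¹)) y z ⟩
        act ((x ∙ (y ⁻¹)) ∙ y) z     ≡⟨ cong (λ t → act t z) (∙⁻¹-∙ x y) ⟩
        act x z                      ∎
        where
        open ≡-Reasoning
        z∈ : z ∈ₑ edge (x ∙ (y ⁻¹))
        z∈ = subst (_∈ₑ edge (x ∙ (y ⁻¹))) (act-⁻¹ y z) (act-edge (y ⁻¹) w∈)

      -- Hence the orbit of z is an edge transversal: the edge labelled x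
      -- contains act x z and, by orbit-on-edge, no other orbit vertex.
      orbit-covers : ∀ a b → T (adj a b) → Orbit a ⊎ Orbit b
      orbit-covers a b ab
        with only-two-ends (edge (joining a b ab)) (adjacent⇒distinct ab) (joining-∋₁ a b ab)
                           (joining-∋₂ a b ab) (act-from-ε (joining a b ab) z∈ε)
      ... | inj₁ ↦a = inj₁ (joining a b ab , ↦a)
      ... | inj₂ ↦b = inj₂ (joining a b ab , ↦b)

      orbit-independent : ∀ a b → T (adj a b) → Orbit a → Orbit b → ⊥
      orbit-independent a b ab a∈ b∈ = adjacent⇒distinct ab
        (trans (orbit-on-edge (joining-∋₁ a b ab) a∈) (sym (orbit-on-edge (joining-∋₂ a b ab) b∈)))

      orbit-transversal : EdgeTransversal adj Orbit
      orbit-transversal = record { covers = orbit-covers ; independent = orbit-independent }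

lineGraph-not-Cayley : ∀ {n p adj} → RegularTriangleFree n p adj → Prime p → 2 < p →
                       OddClosedWalk adj → ¬ IsCayley (LineGraph n adj)
lineGraph-not-Cayley Γ p-prime 2<p walk (G , C , iso) =
  odd-walk-no-transversal walk (Transversal.orbit-transversal p-prime fixed-vertex)
  where
  open ThreeIndices (three-indices 2<p)
  open LineGraphCayley Γ G C iso
  open WhitneyAction i₀ i₁ i₀≢i₁
  open FindFixedVertex i₂ i₀≢i₂ i₁≢i₂

-- The Hoffman–Singleton graph.

-- Neighbours in Robertson's construction (see Defs): P(h,j) is adjacent to
-- P(h,j±1) and to Q(t, h t + j); Q(i,k) is adjacent to Q(i,k±2) and to
-- P(t, k − t i), all indices mod 5.
hsNeighbourℕ : ℕ → ℕ → ℕ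
hsNeighbourℕ x i with x <ᵇ 25 | i
... | true  | 0           = 5 * (x / 5) + (x % 5 + 1) % 5
... | true  | 1           = 5 * (x / 5) + (x % 5 + 4) % 5
... | true  | suc (suc t) = 25 + 5 * t + ((x / 5) * t + x % 5) % 5
... | false | 0           = 25 + 5 * ((x ∸ 25) / 5) + ((x ∸ 25) % 5 + 2) % 5
... | false | 1           = 25 + 5 * ((x ∸ 25) / 5) + ((x ∸ 25) % 5 + 3) % 5
... | false | suc (suc t) = 5 * t + ((x ∸ 25) % 5 + 4 * t * ((x ∸ 25) / 5)) % 5

hsNeighbour : Fin 50 → Fin 7 → Fin 50
hsNeighbour x i = hsNeighbourℕ (toℕ x) (toℕ i) mod 50

hoffmanSingleton-regular : RegularTriangleFree 50 7 hsAdj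
hoffmanSingleton-regular = record
  { irreflexive = from-yes (all? λ x → ¬? (T? (hsAdj x x)))
  ; symmetric = from-yes (all? λ x → all? λ y → T? (hsAdj x y) →-dec T? (hsAdj y x))
  ; neighbour = hsNeighbour
  ; neighbour-adjacent = from-yes (all? λ x → all? λ i → T? (hsAdj x (hsNeighbour x i)))
  ; neighbour-complete = from-yes (all? λ x → all? λ y → T? (hsAdj x y) →-dec any? λ i → hsNeighbour x i ≟ y)
  ; neighbour-injective = from-yes (all? λ x → all? λ i → all? λ j → (hsNeighbour x i ≟ hsNeighbour x j) →-dec (i ≟ j))
  ; neighbourhood-independent =
      from-yes (all? λ x → all? λ i → all? λ j → ¬? (T? (hsAdj (hsNeighbour x i) (hsNeighbour x j))))
  }

-- The pentagon P(0,0) P(0,1) P(0,2) P(0,3) P(0,4).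
pentagon : OddClosedWalk hsAdj
pentagon = record { half = 2 ; vertex = λ i → (i % 5) mod 50 ; step = step ; closed = refl }
  where
  step : ∀ i → i < 5 → T (hsAdj ((i % 5) mod 50) ((suc i % 5) mod 50))
  step 0 _ = _
  step 1 _ = _
  step 2 _ = _
  step 3 _ = _
  step 4 _ = _
  step (suc (suc (suc (suc (suc _))))) (s≤s (s≤s (s≤s (s≤s (s≤s ())))))

proposition5p2 : ¬ IsCayley (LineGraph 50 hsAdj)
proposition5p2 = lineGraph-not-Cayley hoffmanSingleton-regular (from-yes (prime? 7)) (s≤s (s≤s (s≤s z≤n))) pentagon
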